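{- Let $P=(X,<)$ be a finite poset of dimension at most $2$ with a fixed ordered realizer $[L_1,L_2]$ (linear orders on $X$ with $P=L_1\cap L_2$). Let $\mathcal{A},\mathcal{C}$ be an orthogonal pair of $P$, let $P_{\mathcal{C}}$ be the order induced by $P$ on $X_{\mathcal{C}}=\bigcup\{C: C\in\mathcal{C}\}$ (with realizer the restrictions of $L_1,L_2$ to $X_{\mathcal{C}}$), and let $\mathcal{C}'$ be the canonical chain partition of $P_{\mathcal{C}}$. Then $\mathcal{C}',\mathcal{A}$ is again an orthogonal pair of $P$.
   Context: An antichain family is a family of pairwise disjoint antichains; a chain family is a family of pairwise disjoint chains. A chain family $\mathcal{C}$ and an antichain family $\mathcal{A}$ form an orthogonal pair of $P$ if (1) $X=\bigl(\bigcup_{A\in\mathcal{A}}A\bigr)\cup\bigl(\bigcup_{C\in\mathcal{C}}C\bigr)$, and (2) $|A\cap C|=1$ for all $A\in\mathcal{A}$, $C\in\mathcal{C}$. For a finite poset $(Y,<)$, its canonical antichain partition is $A_1,\dots,A_h$ with $A_1=\mathrm{Min}(Y)$ and $A_j=\mathrm{Min}(Y\setminus\bigcup_{i<j}A_i)$, continued until $Y$ is exhausted. For a poset $R$ on $Y$ with ordered realizer $[M_1,M_2]$, the primary conjugate is the poset $Q$ on $Y$ with realizer $[M_1,\overline{M_2}]$, where $\overline{M_2}$ is the reverse of $M_2$; chains of $R$ are exactly antichains of $Q$. The canonical chain partition of $R$ is the canonical antichain partition of $Q$ (viewed as a partition of $Y$ into chains of $R$). -}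

module Defs where

open import Data.Nat using (ℕ; zero; suc; _<_; _<?_)
open import Data.Fin using (Fin)
open import Data.Fin.Subset using (Subset; _∈_; _∩_; _∪_; ⊥; ∣_∣)
open import Data.Fin.Subset.Properties using (_∈?_)
open import Data.Fin.Properties using (any?)
open import Data.Bool using (Bool; _∧_; not)
open import Data.List using (List; []; _∷_; foldr; length; lookup)
open import Data.List.Membership.Propositional renaming (_∈_ to _∈ₗ_)
open import Data.Product using (_×_; ∃; _,_)
open import Data.Sum using (_⊎_)
open import Data.Vec using (tabulate)
open import Relation.Binary.PropositionalEquality using (_≡_; _≢_)
open import Relation.Nullary using (¬_; yes; no; ⌊_⌋)
open import Relation.Nullary.Decidable using (_×-dec_)
open import Function using (Injective)

record LinOrd (n : ℕ) : Set where
  field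
    pos : Fin n → ℕ
    pos-inj : Injective _≡_ _≡_ pos

open LinOrd public

_≺[_]_ : ∀ {n} → Fin n → LinOrd n → Fin n → Set
x ≺[ L ] y = pos L x < pos L y

IsRealizer : ∀ {n} → (Fin n → Fin n → Set) → LinOrd n → LinOrd n → Set
IsRealizer {n} _<P_ L₁ L₂ =
  ∀ (x y : Fin n) → (x <P y → (x ≺[ L₁ ] y × x ≺[ L₂ ] y))
                  × ((x ≺[ L₁ ] y × x ≺[ L₂ ] y) → x <P y)

module _ {n : ℕ} (_<P_ : Fin n → Fin n → Set) where

  IsChain : Subset n → Set
  IsChain C = ∀ x y → x ∈ C → y ∈ C → (x ≡ y) ⊎ (x <P y) ⊎ (y <P x)

  IsAntichain : Subset n → Set
  IsAntichain A = ∀ x y → x ∈ A → y ∈ A → ¬ (x <P y)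

  PairwiseDisjoint : List (Subset n) → Set
  PairwiseDisjoint F =
    ∀ (i j : Fin (length F)) → i ≢ j → ∣ lookup F i ∩ lookup F j ∣ ≡ 0

  ChainFamily : List (Subset n) → Set
  ChainFamily F = PairwiseDisjoint F × (∀ C → C ∈ₗ F → IsChain C)

  AntichainFamily : List (Subset n) → Set
  AntichainFamily F = PairwiseDisjoint F × (∀ A → A ∈ₗ F → IsAntichain A)

  OrthogonalPair : List (Subset n) → List (Subset n) → Set
  OrthogonalPair 𝒞 𝒜 =
    ChainFamily 𝒞 × AntichainFamily 𝒜
    × (∀ (x : Fin n) → (∃ λ A → A ∈ₗ 𝒜 × x ∈ A) ⊎ (∃ λ C → C ∈ₗ 𝒞 × x ∈ C))
    × (∀ A C → A ∈ₗ 𝒜 → C ∈ₗ 𝒞 → ∣ A ∩ C ∣ ≡ 1)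

⋃ : ∀ {n} → List (Subset n) → Subset n
⋃ = foldr _∪_ ⊥

-- Computed with fuel n (each step removes at least
-- one element of a nonempty finite poset, so fuel n suffices).
module Canonical {n : ℕ} (_<Q_ : Fin n → Fin n → Set)
                 (_<Q?_ : ∀ x y → Relation.Nullary.Dec (x <Q y)) where

  Min : Subset n → Subset n
  Min Y = tabulate λ y →
    ⌊ y ∈? Y ⌋ ∧ not ⌊ any? (λ z → (z ∈? Y) ×-dec (z <Q? y)) ⌋

  minus : Subset n → Subset n → Subset n
  minus Y Z = tabulate λ y → ⌊ y ∈? Y ⌋ ∧ not ⌊ y ∈? Z ⌋

  go : ℕ → Subset n → List (Subset n)
  go zero Y = []
  go (suc k) Y with any? (λ y → y ∈? Y)
  ... | no _ = []
  ... | yes _ = Min Y ∷ go k (minus Y (Min Y))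

  canonicalAntichainPartition : Subset n → List (Subset n)
  canonicalAntichainPartition Y = go n Y

-- Primary conjugate Q of the order with realizer [L₁ , L₂]:
-- realizer [L₁ , reverse L₂], i.e. x <Q y iff x ≺₁ y and y ≺₂ x.
_<conj[_,_]_ : ∀ {n} → Fin n → LinOrd n → LinOrd n → Fin n → Set
x <conj[ L₁ , L₂ ] y = x ≺[ L₁ ] y × y ≺[ L₂ ] x

<conj? : ∀ {n} (L₁ L₂ : LinOrd n) (x y : Fin n) →
         Relation.Nullary.Dec (x <conj[ L₁ , L₂ ] y)
<conj? L₁ L₂ x y = (pos L₁ x <? pos L₁ y) ×-dec (pos L₂ y <? pos L₂ x)

-- Canonical chain partition of the suborder of [L₁,L₂] induced on Y
-- (realizer: restrictions of L₁, L₂ to Y) = canonical antichain partition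
-- of its primary conjugate on Y.
canonicalChainPartition : ∀ {n} → LinOrd n → LinOrd n → Subset n → List (Subset n)
canonicalChainPartition L₁ L₂ Y =
  Canonical.canonicalAntichainPartition (λ x y → x <conj[ L₁ , L₂ ] y) (<conj? L₁ L₂) Y

module Submission where

-- Since P = L₁ ∩ L₂, two distinct elements are comparable in exactly one of P
-- and its primary conjugate Q (realizer [L₁ , reverse L₂]); hence antichains of
-- P are chains of Q and chains of P are antichains of Q.  An antichain A of the
-- orthogonal pair meets each chain of 𝒞 exactly once, while a Q-chain meets each
-- of them at most once, so A ∩ X_𝒞 is a longest Q-chain of X_𝒞.  A longest
-- chain of Y meets Min Y (otherwise it could be extended below its minimum),
-- meets it at most once (Min Y is an antichain), and stays a longest chain of
-- Y ∖ Min Y: a chain there extends below its minimum within Y, so it is shorter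
-- than the longest chain, which lost only one element.  So A meets every
-- level of the canonical antichain partition of Q, i.e. every chain of 𝒞',
-- exactly once.

open import Defs
open import Data.Bool using (Bool; true; _∧_; not)
open import Data.Empty using (⊥-elim)
open import Data.Fin using (Fin) renaming (zero to fzero; suc to fsuc)
open import Data.Fin.Properties using (any?) renaming (_≟_ to _≟ᶠ_; suc-injective to fsuc-injective)
open import Data.Fin.Subset using (Subset; _∈_; _∉_; _⊆_; _⊂_; _∩_; _∪_; ∣_∣; ⁅_⁆; Nonempty; Empty; inside; outside) renaming (⊥ to ∅)
open import Data.Fin.Subset.Properties using (_∈?_; ∣p∣≤n; p⊆q⇒∣p∣≤∣q∣; p⊂q⇒∣p∣<∣q∣; ∣⁅x⁆∣≡1; x∈⁅x⁆; x∈⁅y⁆⇒x≡y; Empty-unique; ∣⊥∣≡0; nonempty?; x∈p∩q⁺; x∈p∩q⁻; x∈p∪q⁺; x∈p∪q⁻; p⊆p∪q; p∩q⊆p; p∩q⊆q; ∩-distribˡ-∪; ∉⊥)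
open import Data.List using (List; []; _∷_; length; lookup)
open import Data.List.Membership.Propositional using () renaming (_∈_ to _∈ₗ_)
open import Data.List.Relation.Unary.Any using (here; there)
open import Data.Nat using (ℕ; zero; suc; _+_; _≤_; _<_; z≤n; s≤s)
open import Data.Nat.Induction using (<-wellFounded)
open import Data.Nat.Properties
open import Data.Product using (_×_; ∃; _,_; proj₁; proj₂)
open import Data.Sum using (_⊎_; inj₁; inj₂)
open import Data.Vec using ([]; _∷_; tabulate) renaming (here to hereᵥ; there to thereᵥ)
open import Data.Vec.Properties using (lookup∘tabulate; []=⇒lookup; lookup⇒[]=)
open import Induction.WellFounded using (WellFounded; Acc; acc; module Subrelation)
import Relation.Binary.Construct.On as On
open import Relation.Binary using (Transitive; tri<; tri≈; tri>)
open import Relation.Binary.PropositionalEquality using (_≡_; _≢_; refl; sym; trans; cong; subst)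
open import Relation.Nullary using (¬_; yes; no; Dec; ⌊_⌋)
open import Relation.Nullary.Decidable using (_×-dec_)

∣p∪q∣≤∣p∣+∣q∣ : ∀ {n} (p q : Subset n) → ∣ p ∪ q ∣ ≤ ∣ p ∣ + ∣ q ∣
∣p∪q∣≤∣p∣+∣q∣ [] [] = z≤n
∣p∪q∣≤∣p∣+∣q∣ (inside ∷ p) (inside ∷ q) = s≤s (≤-trans (∣p∪q∣≤∣p∣+∣q∣ p q) (+-monoʳ-≤ ∣ p ∣ (n≤1+n _)))
∣p∪q∣≤∣p∣+∣q∣ (inside ∷ p) (outside ∷ q) = s≤s (∣p∪q∣≤∣p∣+∣q∣ p q)
∣p∪q∣≤∣p∣+∣q∣ (outside ∷ p) (inside ∷ q) =
  subst (suc ∣ p ∪ q ∣ ≤_) (sym (+-suc ∣ p ∣ ∣ q ∣)) (s≤s (∣p∪q∣≤∣p∣+∣q∣ p q))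
∣p∪q∣≤∣p∣+∣q∣ (outside ∷ p) (outside ∷ q) = ∣p∪q∣≤∣p∣+∣q∣ p q

∣p∣+∣q∣≤∣p∪q∣ : ∀ {n} (p q : Subset n) → (∀ {x} → x ∈ p → x ∉ q) → ∣ p ∣ + ∣ q ∣ ≤ ∣ p ∪ q ∣
∣p∣+∣q∣≤∣p∪q∣ [] [] _ = z≤n
∣p∣+∣q∣≤∣p∪q∣ (inside ∷ p) (inside ∷ q) disjoint = ⊥-elim (disjoint hereᵥ hereᵥ)
∣p∣+∣q∣≤∣p∪q∣ (inside ∷ p) (outside ∷ q) disjoint =
  s≤s (∣p∣+∣q∣≤∣p∪q∣ p q (λ x∈p x∈q → disjoint (thereᵥ x∈p) (thereᵥ x∈q)))
∣p∣+∣q∣≤∣p∪q∣ (outside ∷ p) (inside ∷ q) disjoint =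
  subst (_≤ suc ∣ p ∪ q ∣) (sym (+-suc ∣ p ∣ ∣ q ∣))
    (s≤s (∣p∣+∣q∣≤∣p∪q∣ p q (λ x∈p x∈q → disjoint (thereᵥ x∈p) (thereᵥ x∈q))))
∣p∣+∣q∣≤∣p∪q∣ (outside ∷ p) (outside ∷ q) disjoint =
  ∣p∣+∣q∣≤∣p∪q∣ p q (λ x∈p x∈q → disjoint (thereᵥ x∈p) (thereᵥ x∈q))

module _ {n : ℕ} where

  x∈p⇒0<∣p∣ : ∀ {p : Subset n} {x} → x ∈ p → 0 < ∣ p ∣
  x∈p⇒0<∣p∣ {p} {x} x∈p = subst (_≤ ∣ p ∣) (∣⁅x⁆∣≡1 x)
    (p⊆q⇒∣p∣≤∣q∣ (λ y∈⁅x⁆ → subst (_∈ p) (sym (x∈⁅y⁆⇒x≡y x y∈⁅x⁆)) x∈p))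

  ∣p∣≡0⇒x∉p : ∀ {p : Subset n} {x} → ∣ p ∣ ≡ 0 → x ∉ p
  ∣p∣≡0⇒x∉p ∣p∣≡0 x∈p with subst (0 <_) ∣p∣≡0 (x∈p⇒0<∣p∣ x∈p)
  ... | ()

  Empty⇒∣p∣≡0 : ∀ {p : Subset n} → Empty p → ∣ p ∣ ≡ 0
  Empty⇒∣p∣≡0 empty = trans (cong ∣_∣ (Empty-unique empty)) (∣⊥∣≡0 n)

  0<∣p∣⇒Nonempty : ∀ {p : Subset n} → 0 < ∣ p ∣ → Nonempty p
  0<∣p∣⇒Nonempty {p} 0<∣p∣ with nonempty? p
  ... | yes nonempty = nonempty
  ... | no empty with subst (0 <_) (Empty⇒∣p∣≡0 empty) 0<∣p∣
  ... | ()

  ∣p∣≤1 : ∀ {p : Subset n} → (∀ {x y} → x ∈ p → y ∈ p → x ≡ y) → ∣ p ∣ ≤ 1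
  ∣p∣≤1 {p} unique with nonempty? p
  ... | no empty = subst (_≤ 1) (sym (Empty⇒∣p∣≡0 empty)) z≤n
  ... | yes (x , x∈p) = subst (∣ p ∣ ≤_) (∣⁅x⁆∣≡1 x)
    (p⊆q⇒∣p∣≤∣q∣ (λ y∈p → subst (_∈ ⁅ x ⁆) (sym (unique y∈p x∈p)) (x∈⁅x⁆ x)))

  ∈⋃⁺ : ∀ {F : List (Subset n)} {C x} → C ∈ₗ F → x ∈ C → x ∈ ⋃ F
  ∈⋃⁺ (here refl) x∈C = x∈p∪q⁺ (inj₁ x∈C)
  ∈⋃⁺ (there C∈F) x∈C = x∈p∪q⁺ (inj₂ (∈⋃⁺ C∈F x∈C))

  ∈⋃⁻ : ∀ (F : List (Subset n)) {x} → x ∈ ⋃ F → ∃ λ j → x ∈ lookup F j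
  ∈⋃⁻ [] x∈ = ⊥-elim (∉⊥ x∈)
  ∈⋃⁻ (C ∷ F) x∈ with x∈p∪q⁻ C (⋃ F) x∈
  ... | inj₁ x∈C = fzero , x∈C
  ... | inj₂ x∈⋃F with ∈⋃⁻ F x∈⋃F
  ... | j , x∈Fj = fsuc j , x∈Fj

  lookup∈ₗ : ∀ (F : List (Subset n)) j → lookup F j ∈ₗ F
  lookup∈ₗ (C ∷ F) fzero = here refl
  lookup∈ₗ (C ∷ F) (fsuc j) = there (lookup∈ₗ F j)

  ∣D∩⋃F∣≤length : ∀ D (F : List (Subset n)) → (∀ {C} → C ∈ₗ F → ∣ D ∩ C ∣ ≤ 1) →
                  ∣ D ∩ ⋃ F ∣ ≤ length F
  ∣D∩⋃F∣≤length D [] _ = ≤-reflexive (Empty⇒∣p∣≡0 (λ (x , x∈) → ∉⊥ (proj₂ (x∈p∩q⁻ D ∅ x∈))))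
  ∣D∩⋃F∣≤length D (C ∷ F) meets≤1 = begin
    ∣ D ∩ (C ∪ ⋃ F) ∣         ≡⟨ cong ∣_∣ (∩-distribˡ-∪ D C (⋃ F)) ⟩
    ∣ (D ∩ C) ∪ (D ∩ ⋃ F) ∣   ≤⟨ ∣p∪q∣≤∣p∣+∣q∣ (D ∩ C) (D ∩ ⋃ F) ⟩
    ∣ D ∩ C ∣ + ∣ D ∩ ⋃ F ∣   ≤⟨ +-mono-≤ (meets≤1 (here refl)) (∣D∩⋃F∣≤length D F (λ C∈F → meets≤1 (there C∈F))) ⟩
    1 + length F              ∎
    where open ≤-Reasoning

∈tabulate⁻ : ∀ {n} (f : Fin n → Bool) {x} → x ∈ tabulate f → f x ≡ true
∈tabulate⁻ f {x} x∈ = trans (sym (lookup∘tabulate f x)) ([]=⇒lookup x∈)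

∈tabulate⁺ : ∀ {n} (f : Fin n → Bool) {x} → f x ≡ true → x ∈ tabulate f
∈tabulate⁺ f {x} fx = lookup⇒[]= x (tabulate f) (trans (lookup∘tabulate f x) fx)

∧-not-true⁻ : ∀ {A B : Set} (a? : Dec A) (b? : Dec B) → (⌊ a? ⌋ ∧ not ⌊ b? ⌋) ≡ true → A × ¬ B
∧-not-true⁻ (yes a) (no ¬b) _ = a , ¬b
∧-not-true⁻ (yes _) (yes _) ()
∧-not-true⁻ (no _) _ ()

∧-not-true⁺ : ∀ {A B : Set} (a? : Dec A) (b? : Dec B) → A → ¬ B → (⌊ a? ⌋ ∧ not ⌊ b? ⌋) ≡ true
∧-not-true⁺ (yes _) (no _) _ _ = refl
∧-not-true⁺ (yes _) (yes b) _ ¬b = ⊥-elim (¬b b)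
∧-not-true⁺ (no ¬a) _ a _ = ⊥-elim (¬a a)

module _ {n : ℕ} (_R_ : Fin n → Fin n → Set) where

  ∣chain∩antichain∣≤1 : ∀ {C S} → IsChain _R_ C → IsAntichain _R_ S → ∣ C ∩ S ∣ ≤ 1
  ∣chain∩antichain∣≤1 {C} {S} chain antichain = ∣p∣≤1 unique
    where
    unique : ∀ {x y} → x ∈ C ∩ S → y ∈ C ∩ S → x ≡ y
    unique {x} {y} x∈ y∈ with x∈p∩q⁻ C S x∈ | x∈p∩q⁻ C S y∈
    ... | x∈C , x∈S | y∈C , y∈S with chain x y x∈C y∈C
    ... | inj₁ x≡y = x≡y
    ... | inj₂ (inj₁ xRy) = ⊥-elim (antichain x y x∈S y∈S xRy)
    ... | inj₂ (inj₂ yRx) = ⊥-elim (antichain y x y∈S x∈S yRx)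

  PairwiseDisjoint-∷ : ∀ {C F} → PairwiseDisjoint _R_ F →
    (∀ {S} → S ∈ₗ F → ∀ {x} → x ∈ C → x ∉ S) → PairwiseDisjoint _R_ (C ∷ F)
  PairwiseDisjoint-∷ disjoint C#F fzero fzero 0≢0 = ⊥-elim (0≢0 refl)
  PairwiseDisjoint-∷ {C} {F} disjoint C#F fzero (fsuc j) _ = Empty⇒∣p∣≡0 λ where
    (x , x∈) → let x∈C , x∈Fj = x∈p∩q⁻ C (lookup F j) x∈ in C#F (lookup∈ₗ F j) x∈C x∈Fj
  PairwiseDisjoint-∷ {C} {F} disjoint C#F (fsuc i) fzero _ = Empty⇒∣p∣≡0 λ where
    (x , x∈) → let x∈Fi , x∈C = x∈p∩q⁻ (lookup F i) C x∈ in C#F (lookup∈ₗ F i) x∈C x∈Fi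
  PairwiseDisjoint-∷ disjoint C#F (fsuc i) (fsuc j) i≢j = disjoint i j (λ i≡j → i≢j (cong fsuc i≡j))

  PairwiseDisjoint-tail : ∀ {C F} → PairwiseDisjoint _R_ (C ∷ F) → PairwiseDisjoint _R_ F
  PairwiseDisjoint-tail disjoint i j i≢j = disjoint (fsuc i) (fsuc j) (λ i≡j → i≢j (fsuc-injective i≡j))

  PairwiseDisjoint-head : ∀ {C F} → PairwiseDisjoint _R_ (C ∷ F) → ∀ {x} → x ∈ C → x ∉ ⋃ F
  PairwiseDisjoint-head {C} {F} disjoint x∈C x∈⋃F with ∈⋃⁻ F x∈⋃F
  ... | j , x∈Fj = ∣p∣≡0⇒x∉p (disjoint fzero (fsuc j) (λ ())) (x∈p∩q⁺ (x∈C , x∈Fj))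

  length≤∣A∩⋃F∣ : ∀ A (F : List (Subset n)) → PairwiseDisjoint _R_ F →
                  (∀ {C} → C ∈ₗ F → ∣ A ∩ C ∣ ≡ 1) → length F ≤ ∣ A ∩ ⋃ F ∣
  length≤∣A∩⋃F∣ A [] _ _ = z≤n
  length≤∣A∩⋃F∣ A (C ∷ F) disjoint meets1 = begin
    1 + length F              ≤⟨ +-mono-≤ (≤-reflexive (sym (meets1 (here refl))))
                                   (length≤∣A∩⋃F∣ A F (PairwiseDisjoint-tail disjoint) (λ C∈F → meets1 (there C∈F))) ⟩
    ∣ A ∩ C ∣ + ∣ A ∩ ⋃ F ∣   ≤⟨ ∣p∣+∣q∣≤∣p∪q∣ (A ∩ C) (A ∩ ⋃ F) separated ⟩
    ∣ (A ∩ C) ∪ (A ∩ ⋃ F) ∣   ≡⟨ cong ∣_∣ (sym (∩-distribˡ-∪ A C (⋃ F))) ⟩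
    ∣ A ∩ (C ∪ ⋃ F) ∣         ∎
    where
    open ≤-Reasoning
    separated : ∀ {x} → x ∈ A ∩ C → x ∉ A ∩ ⋃ F
    separated x∈A∩C x∈A∩⋃F =
      PairwiseDisjoint-head disjoint (p∩q⊆q A C x∈A∩C) (p∩q⊆q A (⋃ F) x∈A∩⋃F)

module CanonicalPartition {n : ℕ} (_≺_ : Fin n → Fin n → Set) (_≺?_ : ∀ x y → Dec (x ≺ y))
                          (≺-wellFounded : WellFounded _≺_) (≺-trans : Transitive _≺_) where

  open Canonical _≺_ _≺?_

  Minimal : Subset n → Fin n → Set
  Minimal S m = m ∈ S × (∀ {z} → z ∈ S → ¬ z ≺ m)

  ∈Min⁻ : ∀ {Y y} → y ∈ Min Y → Minimal Y y
  ∈Min⁻ {Y} {y} y∈ with ∧-not-true⁻ (y ∈? Y) (any? (λ z → (z ∈? Y) ×-dec (z ≺? y))) (∈tabulate⁻ _ y∈)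
  ... | y∈Y , nothing-below = y∈Y , λ {z} z∈Y z≺y → nothing-below (z , z∈Y , z≺y)

  ∈Min⁺ : ∀ {Y y} → Minimal Y y → y ∈ Min Y
  ∈Min⁺ {Y} {y} (y∈Y , minimal) = ∈tabulate⁺ _
    (∧-not-true⁺ (y ∈? Y) (any? (λ z → (z ∈? Y) ×-dec (z ≺? y))) y∈Y (λ (z , z∈Y , z≺y) → minimal z∈Y z≺y))

  ∉Min⇒below : ∀ {Y y} → y ∈ Y → y ∉ Min Y → ∃ λ z → z ∈ Y × z ≺ y
  ∉Min⇒below {Y} {y} y∈Y y∉Min with any? (λ z → (z ∈? Y) ×-dec (z ≺? y))
  ... | yes below = below
  ... | no nothing-below = ⊥-elim (y∉Min (∈Min⁺ (y∈Y , λ z∈Y z≺y → nothing-below (_ , z∈Y , z≺y))))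

  ∈minus⁻ : ∀ {Y Z y} → y ∈ minus Y Z → y ∈ Y × y ∉ Z
  ∈minus⁻ {Y} {Z} {y} y∈ = ∧-not-true⁻ (y ∈? Y) (y ∈? Z) (∈tabulate⁻ _ y∈)

  ∈minus⁺ : ∀ {Y Z y} → y ∈ Y → y ∉ Z → y ∈ minus Y Z
  ∈minus⁺ {Y} {Z} {y} y∈Y y∉Z = ∈tabulate⁺ _ (∧-not-true⁺ (y ∈? Y) (y ∈? Z) y∈Y y∉Z)

  minimal-exists : ∀ {S x} → x ∈ S → ∃ (Minimal S)
  minimal-exists {S} {x} = descend (≺-wellFounded x)
    where
    descend : ∀ {x} → Acc _≺_ x → x ∈ S → ∃ (Minimal S)
    descend {x} (acc below) x∈S with any? (λ z → (z ∈? S) ×-dec (z ≺? x))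
    ... | yes (z , z∈S , z≺x) = descend (below z≺x) z∈S
    ... | no nothing-below = x , x∈S , λ z∈S z≺x → nothing-below (_ , z∈S , z≺x)

  Min-antichain : ∀ Y → IsAntichain _≺_ (Min Y)
  Min-antichain Y x y x∈ y∈ = proj₂ (∈Min⁻ y∈) (proj₁ (∈Min⁻ x∈))

  go-⊆ : ∀ k Y {S} → S ∈ₗ go k Y → S ⊆ Y
  go-⊆ zero Y ()
  go-⊆ (suc k) Y S∈ with any? (λ y → y ∈? Y)
  go-⊆ (suc k) Y () | no _
  go-⊆ (suc k) Y (here refl) | yes _ = λ x∈ → proj₁ (∈Min⁻ x∈)
  go-⊆ (suc k) Y (there S∈) | yes _ = λ x∈ → proj₁ (∈minus⁻ (go-⊆ k _ S∈ x∈))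

  go-antichain : ∀ k Y {S} → S ∈ₗ go k Y → IsAntichain _≺_ S
  go-antichain zero Y ()
  go-antichain (suc k) Y S∈ with any? (λ y → y ∈? Y)
  go-antichain (suc k) Y () | no _
  go-antichain (suc k) Y (here refl) | yes _ = Min-antichain Y
  go-antichain (suc k) Y (there S∈) | yes _ = go-antichain k _ S∈

  -- PairwiseDisjoint takes an order argument that its definition ignores.
  go-disjoint : ∀ (R : Fin n → Fin n → Set) k Y → PairwiseDisjoint R (go k Y)
  go-disjoint R zero Y = λ ()
  go-disjoint R (suc k) Y with any? (λ y → y ∈? Y)
  ... | no _ = λ ()
  ... | yes _ = PairwiseDisjoint-∷ R (go-disjoint R k (minus Y (Min Y))) (λ S∈ x∈Min x∈S → proj₂ (∈minus⁻ (go-⊆ k _ S∈ x∈S)) x∈Min)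

  go-covers : ∀ k Y → ∣ Y ∣ ≤ k → ∀ {x} → x ∈ Y → ∃ λ S → S ∈ₗ go k Y × x ∈ S
  go-covers zero Y ∣Y∣≤0 x∈Y with ≤-trans (x∈p⇒0<∣p∣ x∈Y) ∣Y∣≤0
  ... | ()
  go-covers (suc k) Y ∣Y∣≤1+k {x} x∈Y with any? (λ y → y ∈? Y)
  ... | no empty = ⊥-elim (empty (x , x∈Y))
  ... | yes _ with x ∈? Min Y
  ... | yes x∈Min = Min Y , here refl , x∈Min
  ... | no x∉Min =
    let S , S∈ , x∈S = go-covers k (minus Y (Min Y)) (≤-pred (<-≤-trans (p⊂q⇒∣p∣<∣q∣ Y∖Min⊂Y) ∣Y∣≤1+k))
                                 (∈minus⁺ x∈Y x∉Min)
    in S , there S∈ , x∈S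
    where
    Y∖Min⊂Y : minus Y (Min Y) ⊂ Y
    Y∖Min⊂Y =
      let m , m∈Y , m-minimal = minimal-exists x∈Y
      in (λ y∈ → proj₁ (∈minus⁻ y∈)) , m , m∈Y , (λ m∈ → proj₂ (∈minus⁻ m∈) (∈Min⁺ (m∈Y , m-minimal)))

  LongestChainTrace : Subset n → Subset n → Set
  LongestChainTrace A Y = ∀ D → D ⊆ Y → IsChain _≺_ D → ∣ D ∣ ≤ ∣ A ∩ Y ∣

  ⁅⁆-chain : ∀ y → IsChain _≺_ ⁅ y ⁆
  ⁅⁆-chain y x z x∈ z∈ = inj₁ (trans (x∈⁅y⁆⇒x≡y y x∈) (sym (x∈⁅y⁆⇒x≡y y z∈)))

  chain-∪-below : ∀ {D w} → IsChain _≺_ D → (∀ {x} → x ∈ D → w ≺ x) → IsChain _≺_ (D ∪ ⁅ w ⁆)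
  chain-∪-below {D} {w} chain w≺D x y x∈ y∈ with x∈p∪q⁻ D ⁅ w ⁆ x∈ | x∈p∪q⁻ D ⁅ w ⁆ y∈
  ... | inj₁ x∈D | inj₁ y∈D = chain x y x∈D y∈D
  ... | inj₁ x∈D | inj₂ y∈w rewrite x∈⁅y⁆⇒x≡y w y∈w = inj₂ (inj₂ (w≺D x∈D))
  ... | inj₂ x∈w | inj₁ y∈D rewrite x∈⁅y⁆⇒x≡y w x∈w = inj₂ (inj₁ (w≺D y∈D))
  ... | inj₂ x∈w | inj₂ y∈w = inj₁ (trans (x∈⁅y⁆⇒x≡y w x∈w) (sym (x∈⁅y⁆⇒x≡y w y∈w)))

  below-minimal⇒below-chain : ∀ {D d w} → IsChain _≺_ D → Minimal D d → w ≺ d → ∀ {x} → x ∈ D → w ≺ x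
  below-minimal⇒below-chain {d = d} chain (d∈D , d-minimal) w≺d {x} x∈D with chain x d x∈D d∈D
  ... | inj₁ refl = w≺d
  ... | inj₂ (inj₁ x≺d) = ⊥-elim (d-minimal x∈D x≺d)
  ... | inj₂ (inj₂ d≺x) = ≺-trans w≺d d≺x

  shorter-than-longest : ∀ A {Y D d w} → LongestChainTrace A Y → D ⊆ Y → IsChain _≺_ D →
                         Minimal D d → w ∈ Y → w ≺ d → ∣ D ∣ < ∣ A ∩ Y ∣
  shorter-than-longest A {Y} {D} {d} {w} longest D⊆Y chain d-minimal w∈Y w≺d = begin-strict
    ∣ D ∣             <⟨ p⊂q⇒∣p∣<∣q∣ (p⊆p∪q ⁅ w ⁆ , w , x∈p∪q⁺ (inj₂ (x∈⁅x⁆ w)) , w∉D) ⟩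
    ∣ D ∪ ⁅ w ⁆ ∣     ≤⟨ longest (D ∪ ⁅ w ⁆) D∪w⊆Y (chain-∪-below chain (below-minimal⇒below-chain chain d-minimal w≺d)) ⟩
    ∣ A ∩ Y ∣         ∎
    where
    open ≤-Reasoning
    w∉D : w ∉ D
    w∉D w∈D = proj₂ d-minimal w∈D w≺d
    D∪w⊆Y : D ∪ ⁅ w ⁆ ⊆ Y
    D∪w⊆Y x∈ with x∈p∪q⁻ D ⁅ w ⁆ x∈
    ... | inj₁ x∈D = D⊆Y x∈D
    ... | inj₂ x∈w rewrite x∈⁅y⁆⇒x≡y w x∈w = w∈Y

  module _ {A : Subset n} (A-chain : IsChain _≺_ A) where

    longest-meets-Min : ∀ {Y y} → LongestChainTrace A Y → y ∈ Y → ∃ λ a → a ∈ A × a ∈ Min Y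
    longest-meets-Min {Y} {y} longest y∈Y =
      let a₀ , a₀∈A∩Y = 0<∣p∣⇒Nonempty (subst (_≤ ∣ A ∩ Y ∣) (∣⁅x⁆∣≡1 y) (longest ⁅ y ⁆ y⊆Y (⁅⁆-chain y)))
          a , a∈A∩Y , a-minimal = minimal-exists a₀∈A∩Y
          nothing-below-a : ∀ {z} → z ∈ Y → ¬ z ≺ a
          nothing-below-a z∈Y z≺a = <-irrefl refl
            (shorter-than-longest A longest (p∩q⊆q A Y) A∩Y-chain (a∈A∩Y , a-minimal) z∈Y z≺a)
      in a , p∩q⊆p A Y a∈A∩Y , ∈Min⁺ (p∩q⊆q A Y a∈A∩Y , nothing-below-a)
      where
      y⊆Y : ⁅ y ⁆ ⊆ Y
      y⊆Y x∈ = subst (_∈ Y) (sym (x∈⁅y⁆⇒x≡y y x∈)) y∈Y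
      A∩Y-chain : IsChain _≺_ (A ∩ Y)
      A∩Y-chain x z x∈ z∈ = A-chain x z (p∩q⊆p A Y x∈) (p∩q⊆p A Y z∈)

    longest-minus-Min : ∀ {Y} → LongestChainTrace A Y → LongestChainTrace A (minus Y (Min Y))
    longest-minus-Min {Y} longest D D⊆Y′ chain with nonempty? D
    ... | no empty = subst (_≤ _) (sym (Empty⇒∣p∣≡0 empty)) z≤n
    ... | yes (_ , x∈D) =
      let d , d-minimal = minimal-exists x∈D
          d∈Y , d∉Min = ∈minus⁻ (D⊆Y′ (proj₁ d-minimal))
          w , w∈Y , w≺d = ∉Min⇒below d∈Y d∉Min
      in ≤-pred (<-≤-trans (shorter-than-longest A longest (λ x∈ → proj₁ (∈minus⁻ (D⊆Y′ x∈))) chain d-minimal w∈Y w≺d)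
                           ∣A∩Y∣≤1+∣A∩Y′∣)
      where
      open ≤-Reasoning
      Y′ : Subset n
      Y′ = minus Y (Min Y)
      Y⊆Min∪Y′ : Y ⊆ Min Y ∪ Y′
      Y⊆Min∪Y′ {y} y∈Y with y ∈? Min Y
      ... | yes y∈Min = x∈p∪q⁺ (inj₁ y∈Min)
      ... | no y∉Min = x∈p∪q⁺ (inj₂ (∈minus⁺ y∈Y y∉Min))
      ∣A∩Y∣≤1+∣A∩Y′∣ : ∣ A ∩ Y ∣ ≤ 1 + ∣ A ∩ Y′ ∣
      ∣A∩Y∣≤1+∣A∩Y′∣ = begin
        ∣ A ∩ Y ∣                         ≤⟨ p⊆q⇒∣p∣≤∣q∣ (λ x∈ → x∈p∩q⁺ (p∩q⊆p A Y x∈ , Y⊆Min∪Y′ (p∩q⊆q A Y x∈))) ⟩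
        ∣ A ∩ (Min Y ∪ Y′) ∣              ≡⟨ cong ∣_∣ (∩-distribˡ-∪ A (Min Y) Y′) ⟩
        ∣ (A ∩ Min Y) ∪ (A ∩ Y′) ∣        ≤⟨ ∣p∪q∣≤∣p∣+∣q∣ (A ∩ Min Y) (A ∩ Y′) ⟩
        ∣ A ∩ Min Y ∣ + ∣ A ∩ Y′ ∣        ≤⟨ +-monoˡ-≤ _ (∣chain∩antichain∣≤1 _≺_ A-chain (Min-antichain Y)) ⟩
        1 + ∣ A ∩ Y′ ∣                    ∎

    longest-meets-go : ∀ k Y → LongestChainTrace A Y → ∀ {S} → S ∈ₗ go k Y → ∣ A ∩ S ∣ ≡ 1
    longest-meets-go zero Y longest ()
    longest-meets-go (suc k) Y longest S∈ with any? (λ y → y ∈? Y)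
    longest-meets-go (suc k) Y longest () | no _
    longest-meets-go (suc k) Y longest (here refl) | yes (_ , y∈Y) =
      let a , a∈A , a∈Min = longest-meets-Min longest y∈Y
      in ≤-antisym (∣chain∩antichain∣≤1 _≺_ A-chain (Min-antichain Y)) (x∈p⇒0<∣p∣ (x∈p∩q⁺ (a∈A , a∈Min)))
    longest-meets-go (suc k) Y longest (there S∈) | yes _ = longest-meets-go k _ (longest-minus-Min longest) S∈

module Dimension2 {n : ℕ} (_<P_ : Fin n → Fin n → Set) (L₁ L₂ : LinOrd n) (realizer : IsRealizer _<P_ L₁ L₂) where

  _<Q_ : Fin n → Fin n → Set
  x <Q y = x <conj[ L₁ , L₂ ] y

  <Q-trans : Transitive _<Q_
  <Q-trans (x≺₁y , y≺₂x) (y≺₁z , z≺₂y) = <-trans x≺₁y y≺₁z , <-trans z≺₂y y≺₂x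

  <Q-wellFounded : WellFounded _<Q_
  <Q-wellFounded = Subrelation.wellFounded proj₁ (On.wellFounded (pos L₁) <-wellFounded)

  P-or-Q-comparable : ∀ {x y} → x ≢ y → (x <P y ⊎ y <P x) ⊎ (x <Q y ⊎ y <Q x)
  P-or-Q-comparable {x} {y} x≢y with <-cmp (pos L₁ x) (pos L₁ y) | <-cmp (pos L₂ x) (pos L₂ y)
  ... | tri≈ _ x=₁y _ | _ = ⊥-elim (x≢y (pos-inj L₁ x=₁y))
  ... | _ | tri≈ _ x=₂y _ = ⊥-elim (x≢y (pos-inj L₂ x=₂y))
  ... | tri< x≺₁y _ _ | tri< x≺₂y _ _ = inj₁ (inj₁ (proj₂ (realizer x y) (x≺₁y , x≺₂y)))
  ... | tri> _ _ y≺₁x | tri> _ _ y≺₂x = inj₁ (inj₂ (proj₂ (realizer y x) (y≺₁x , y≺₂x)))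
  ... | tri< x≺₁y _ _ | tri> _ _ y≺₂x = inj₂ (inj₁ (x≺₁y , y≺₂x))
  ... | tri> _ _ y≺₁x | tri< x≺₂y _ _ = inj₂ (inj₂ (y≺₁x , x≺₂y))

  <P⇒≮Q : ∀ {x y} → x <P y → ¬ x <Q y
  <P⇒≮Q {x} {y} x<y (_ , y≺₂x) = <-asym (proj₂ (proj₁ (realizer x y) x<y)) y≺₂x

  <P⇒≯Q : ∀ {x y} → x <P y → ¬ y <Q x
  <P⇒≯Q {x} {y} x<y (y≺₁x , _) = <-asym (proj₁ (proj₁ (realizer x y) x<y)) y≺₁x

  antichain⇒Q-chain : ∀ {A} → IsAntichain _<P_ A → IsChain _<Q_ A
  antichain⇒Q-chain antichain x y x∈ y∈ with x ≟ᶠ y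
  ... | yes x≡y = inj₁ x≡y
  ... | no x≢y with P-or-Q-comparable x≢y
  ... | inj₁ (inj₁ x<y) = ⊥-elim (antichain x y x∈ y∈ x<y)
  ... | inj₁ (inj₂ y<x) = ⊥-elim (antichain y x y∈ x∈ y<x)
  ... | inj₂ Q-comparable = inj₂ Q-comparable

  Q-antichain⇒chain : ∀ {S} → IsAntichain _<Q_ S → IsChain _<P_ S
  Q-antichain⇒chain antichain x y x∈ y∈ with x ≟ᶠ y
  ... | yes x≡y = inj₁ x≡y
  ... | no x≢y with P-or-Q-comparable x≢y
  ... | inj₁ P-comparable = inj₂ P-comparable
  ... | inj₂ (inj₁ x<y) = ⊥-elim (antichain x y x∈ y∈ x<y)
  ... | inj₂ (inj₂ y<x) = ⊥-elim (antichain y x y∈ x∈ y<x)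

  chain⇒Q-antichain : ∀ {C} → IsChain _<P_ C → IsAntichain _<Q_ C
  chain⇒Q-antichain chain x y x∈ y∈ x<Qy with chain x y x∈ y∈
  ... | inj₁ refl = <-irrefl refl (proj₁ x<Qy)
  ... | inj₂ (inj₁ x<y) = <P⇒≮Q x<y x<Qy
  ... | inj₂ (inj₂ y<x) = <P⇒≯Q y<x x<Qy

  open CanonicalPartition _<Q_ (<conj? L₁ L₂) <Q-wellFounded <Q-trans public

  orthogonal-trace-longest : ∀ A (𝒞 : List (Subset n)) → ChainFamily _<P_ 𝒞 →
    (∀ {C} → C ∈ₗ 𝒞 → ∣ A ∩ C ∣ ≡ 1) → LongestChainTrace A (⋃ 𝒞)
  orthogonal-trace-longest A 𝒞 (disjoint , chains) meets1 D D⊆X chain = begin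
    ∣ D ∣             ≤⟨ p⊆q⇒∣p∣≤∣q∣ (λ x∈D → x∈p∩q⁺ (x∈D , D⊆X x∈D)) ⟩
    ∣ D ∩ ⋃ 𝒞 ∣       ≤⟨ ∣D∩⋃F∣≤length D 𝒞 (λ C∈ → ∣chain∩antichain∣≤1 _<Q_ chain (chain⇒Q-antichain (chains _ C∈))) ⟩
    length 𝒞          ≤⟨ length≤∣A∩⋃F∣ _<P_ A 𝒞 disjoint meets1 ⟩
    ∣ A ∩ ⋃ 𝒞 ∣       ∎
    where open ≤-Reasoning

lemma2 : (n : ℕ) (_<P_ : Fin n → Fin n → Set) (L₁ L₂ : LinOrd n) →
    IsRealizer _<P_ L₁ L₂ →
    (𝒜 𝒞 : List (Subset n)) →
    OrthogonalPair _<P_ 𝒞 𝒜 →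
    OrthogonalPair _<P_ (canonicalChainPartition L₁ L₂ (⋃ 𝒞)) 𝒜
lemma2 n _<P_ L₁ L₂ realizer 𝒜 𝒞 (𝒞-family , 𝒜-family@(_ , antichains) , covers , meets1) =
  (go-disjoint _<P_ n X , (λ _ S∈ → Q-antichain⇒chain (go-antichain n X S∈))) , 𝒜-family , covers′ , meets1′
  where
  open Dimension2 _<P_ L₁ L₂ realizer
  X : Subset n
  X = ⋃ 𝒞
  covers′ : ∀ x → (∃ λ A → A ∈ₗ 𝒜 × x ∈ A) ⊎ (∃ λ S → S ∈ₗ canonicalChainPartition L₁ L₂ X × x ∈ S)
  covers′ x with covers x
  ... | inj₁ in-𝒜 = inj₁ in-𝒜
  ... | inj₂ (_ , C∈𝒞 , x∈C) = inj₂ (go-covers n X (∣p∣≤n X) (∈⋃⁺ C∈𝒞 x∈C))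
  meets1′ : ∀ A S → A ∈ₗ 𝒜 → S ∈ₗ canonicalChainPartition L₁ L₂ X → ∣ A ∩ S ∣ ≡ 1
  meets1′ A S A∈𝒜 S∈ = longest-meets-go (antichain⇒Q-chain (antichains A A∈𝒜)) n X
    (orthogonal-trace-longest A 𝒞 𝒞-family (λ C∈𝒞 → meets1 A _ A∈𝒜 C∈𝒞)) S∈
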